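{- Let $H$ be a $k$-strong digraph of order $n\geq 4$, where $k\geq 2$. Then for every vertex $z$ of $H$, the digraph $D_H(z)$ is $(k+1)$-strong.
   Context: All digraphs are finite, without loops and without multiple arcs. A digraph $D$ is $k$-strong if $|V(D)|\geq k+1$ and $D-A$ is strongly connected for every set $A$ of at most $k-1$ vertices. For a digraph $H$ and a vertex $z$ of $H$, $D_H(z)$ is the digraph with vertex set $(V(H)\setminus\{z\})\cup\{u,v\}$, where $u,v$ are two new vertices, and arc set consisting of all arcs of $H-\{z\}$, the arcs $uv$ and $vu$, the arcs $xu$ and $vx$ for every $x\in V(H)\setminus\{z\}$, the arcs $ux$ for every $x$ with $zx\in A(H)$, and the arcs $xv$ for every $x$ with $xz\in A(H)$. -}

module Defs where

open import Data.Nat using (ℕ; zero; suc; _≤_; _∸_; _+_)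
open import Data.Fin using (Fin; zero; suc)
open import Data.Fin.Properties using (_≟_)
open import Data.Fin.Subset using (Subset; _∉_; ∣_∣)
open import Data.Bool using (Bool; true; false)
open import Data.Product using (_×_)
open import Relation.Nullary using (yes; no)
open import Relation.Binary.PropositionalEquality using (_≡_; refl)

record Digraph (n : ℕ) : Set where
  field
    arc      : Fin n → Fin n → Bool
    loopless : ∀ x → arc x x ≡ false
open Digraph public

-- Walks in D - A from x to y: all vertices of the walk lie outside A.
data Walk {n : ℕ} (D : Digraph n) (A : Subset n) : Fin n → Fin n → Set where
  here : ∀ {x} → x ∉ A → Walk D A x x
  step : ∀ {x y w} → x ∉ A → arc D x y ≡ true → Walk D A y w → Walk D A x w

StronglyConnectedMinus : ∀ {n} → Digraph n → Subset n → Set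
StronglyConnectedMinus {n} D A = (x y : Fin n) → x ∉ A → y ∉ A → Walk D A x y

IsKStrong : ∀ {n} → ℕ → Digraph n → Set
IsKStrong {n} k D =
  (suc k ≤ n) × ((A : Subset n) → ∣ A ∣ ≤ k ∸ 1 → StronglyConnectedMinus D A)

-- D_H(z), on vertex set Fin (suc n):
--   zero      plays the role of the new vertex v,
--   suc z     plays the role of the new vertex u,
--   suc x     (x ≠ z) is the vertex x of H - z.
DH-arc : ∀ {n} → Digraph n → Fin n → Fin (suc n) → Fin (suc n) → Bool
DH-arc H z zero    zero    = false
DH-arc H z zero    (suc y) = true                 -- v u and v x
DH-arc H z (suc x) zero with x ≟ z
... | yes _ = true                                -- u v
... | no  _ = arc H x z                           -- x v iff x z ∈ A(H)
DH-arc H z (suc x) (suc y) with x ≟ z | y ≟ z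
... | yes _ | yes _ = false
... | yes _ | no  _ = arc H z y                   -- u x iff z x ∈ A(H)
... | no  _ | yes _ = true                        -- x u
... | no  _ | no  _ = arc H x y                   -- arcs of H - z

DH-loopless : ∀ {n} (H : Digraph n) (z : Fin n) (x : Fin (suc n)) → DH-arc H z x x ≡ false
DH-loopless H z zero = refl
DH-loopless H z (suc x) with x ≟ z
... | yes _ = refl
... | no  _ = loopless H x

D_H : ∀ {n} → Digraph n → Fin n → Digraph (suc n)
D_H H z = record { arc = DH-arc H z ; loopless = DH-loopless H z }

module Submission where

-- Write v = zero and u = suc z for the two new vertices of
-- D = D_H(z), and let A be a set of at most k vertices of D.  We show that
-- D - A is strongly connected, distinguishing three cases.
--   * v ∈ A: the map x ↦ suc x (z playing the role of u) embeds H into D,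
--     so D - A inherits strong connectivity from H - A', where A' is A
--     read back in H and has at most k - 1 elements.
--   * u, v ∉ A: every vertex reaches u, u → v, and v reaches every vertex,
--     so v is a hub of D - A.

open import Defs
open import Data.Nat using (ℕ; suc; _≤_; _<_; _∸_; s≤s)
open import Data.Nat.Properties using (<⇒≤pred; <-≤-trans; pred[m∸n]≡m∸[1+n])
open import Data.Fin using (Fin; zero; suc)
open import Data.Fin.Properties using (_≟_)
open import Data.Fin.Subset using (Subset; inside; outside; _∈_; _∉_; _-_; ∣_∣)
open import Data.Fin.Subset.Properties
  using (_∈?_; drop-there; drop-not-there; x∈p∧x≢y⇒x∈p-y; x∈p⇒∣p-x∣<∣p∣; p─q⊆p)
open import Data.Vec using (_∷_; here; there)
open import Data.Bool using (true)
open import Data.Product using (∃; _×_; _,_)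
open import Data.Empty using (⊥)
open import Function using (_∘_; case_of_)
open import Relation.Nullary using (yes; no; contradiction)
open import Relation.Binary.PropositionalEquality using (_≡_; _≢_; refl; sym; trans; subst)

<⇒≤∸1 : ∀ {m k} → m < k → m ≤ k ∸ 1
<⇒≤∸1 {m} {k} m<k = subst (m ≤_) (pred[m∸n]≡m∸[1+n] k 0) (<⇒≤pred m<k)

x∉p-x : ∀ {n} (p : Subset n) (x : Fin n) → x ∉ p - x
x∉p-x (_ ∷ p) zero    ()
x∉p-x (_ ∷ p) (suc x) (there x∈p-x) = x∉p-x p x x∈p-x

_++ʷ_ : ∀ {n} {D : Digraph n} {A x y w} → Walk D A x y → Walk D A y w → Walk D A x w
here _       ++ʷ q = q
step x∉A a p ++ʷ q = step x∉A a (p ++ʷ q)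

ArcPreserving : ∀ {n m} → Digraph n → Digraph m → (Fin n → Fin m) → Set
ArcPreserving D D' f = ∀ a b → arc D a b ≡ true → arc D' (f a) (f b) ≡ true

transfer : ∀ {n m} {D : Digraph n} {D' : Digraph m} {B A} (f : Fin n → Fin m) →
  ArcPreserving D D' f →
  (∀ x → x ∉ B → f x ∉ A) →
  (∀ y → y ∉ A → ∃ λ x → x ∉ B × f x ≡ y) →
  StronglyConnectedMinus D B → StronglyConnectedMinus D' A
transfer {D = D} {D'} {B} {A} f f-arc f-out f-onto conn y y' y∉A y'∉A
  with f-onto y y∉A | f-onto y' y'∉A
... | x , x∉B , refl | x' , x'∉B , refl = mapWalk (conn x x' x∉B x'∉B)
  where
  mapWalk : ∀ {a b} → Walk D B a b → Walk D' A (f a) (f b)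
  mapWalk (here a∉B)     = here (f-out _ a∉B)
  mapWalk (step a∉B e p)   = step (f-out _ a∉B) (f-arc _ _ e) (mapWalk p)

hub-connected : ∀ {n} {D : Digraph n} {A} (c : Fin n) →
  (∀ x → x ∉ A → Walk D A x c) → (∀ y → y ∉ A → Walk D A c y) →
  StronglyConnectedMinus D A
hub-connected c to from x y x∉A y∉A = to x x∉A ++ʷ from y y∉A

module _ {n : ℕ} (H : Digraph n) (z : Fin n) where

  D : Digraph (suc n)
  D = D_H H z

  no-self-arc : ∀ {x} → arc H x x ≡ true → ⊥
  no-self-arc {x} e with trans (sym e) (loopless H x)
  ... | ()

  -- The arcs of D_H(z) used below (v = zero, u = suc z); hypotheses of the
  -- form x ≡ z let them be applied after a case split on x ≟ z.
  arc-uv : arc D (suc z) zero ≡ true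
  arc-uv with z ≟ z
  ... | yes _  = refl
  ... | no z≢z = contradiction refl z≢z

  arc-xu : ∀ {x y} → x ≢ z → y ≡ z → arc D (suc x) (suc y) ≡ true
  arc-xu {x} x≢z refl with x ≟ z | z ≟ z
  ... | yes x≡z | _      = contradiction x≡z x≢z
  ... | no _    | yes _  = refl
  ... | no _    | no z≢z = contradiction refl z≢z

  arc-ux : ∀ {x y} → x ≡ z → arc H x y ≡ true → arc D (suc x) (suc y) ≡ true
  arc-ux {y = y} refl e with z ≟ z | y ≟ z
  ... | no z≢z | _        = contradiction refl z≢z
  ... | yes _  | yes refl = contradiction e no-self-arc
  ... | yes _  | no _     = e

  arc-xv : ∀ {x y} → x ≢ z → y ≡ z → arc H x y ≡ true → arc D (suc x) zero ≡ true
  arc-xv {x} x≢z refl e with x ≟ z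
  ... | yes x≡z = contradiction x≡z x≢z
  ... | no _    = e

  arc-xy : ∀ {x y} → x ≢ z → y ≢ z → arc H x y ≡ true → arc D (suc x) (suc y) ≡ true
  arc-xy {x} {y} x≢z y≢z e with x ≟ z | y ≟ z
  ... | yes x≡z | _       = contradiction x≡z x≢z
  ... | no _    | yes y≡z = contradiction y≡z y≢z
  ... | no _    | no _    = e

  asU-arc : ArcPreserving H D suc
  asU-arc a b e = case ((a ≟ z) , (b ≟ z)) of λ where
    (yes a≡z , _)       → arc-ux a≡z e
    (no a≢z  , yes b≡z) → arc-xu a≢z b≡z
    (no a≢z  , no b≢z)  → arc-xy a≢z b≢z e

  asV : Fin n → Fin (suc n)
  asV x with x ≟ z
  ... | yes _ = zero
  ... | no _  = suc x

  asV-≡ : ∀ {x} → x ≡ z → asV x ≡ zero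
  asV-≡ {x} x≡z with x ≟ z
  ... | yes _   = refl
  ... | no x≢z  = contradiction x≡z x≢z

  asV-≢ : ∀ {x} → x ≢ z → asV x ≡ suc x
  asV-≢ {x} x≢z with x ≟ z
  ... | yes x≡z = contradiction x≡z x≢z
  ... | no _    = refl

  arc-cong : ∀ {p p' q q'} → p ≡ p' → q ≡ q' → arc D p q ≡ true → arc D p' q' ≡ true
  arc-cong refl refl e = e

  asV-arc : ArcPreserving H D asV
  asV-arc a b e = case ((a ≟ z) , (b ≟ z)) of λ where
    (yes a≡z , yes b≡z) →
      contradiction (subst (λ w → arc H a w ≡ true) (trans b≡z (sym a≡z)) e) no-self-arc
    (yes a≡z , no b≢z)  → arc-cong (sym (asV-≡ a≡z)) (sym (asV-≢ b≢z)) refl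
    (no a≢z  , yes b≡z) → arc-cong (sym (asV-≢ a≢z)) (sym (asV-≡ b≡z)) (arc-xv a≢z b≡z e)
    (no a≢z  , no b≢z)  → arc-cong (sym (asV-≢ a≢z)) (sym (asV-≢ b≢z)) (arc-xy a≢z b≢z e)

  connected-without-v : ∀ A' → StronglyConnectedMinus H A' →
                        StronglyConnectedMinus D (inside ∷ A')
  connected-without-v A' = transfer suc asU-arc (λ x x∉A' → x∉A' ∘ drop-there) onto
    where
    onto : ∀ y → y ∉ inside ∷ A' → ∃ λ x → x ∉ A' × suc x ≡ y
    onto zero    v∉A  = contradiction here v∉A
    onto (suc x) sx∉A = x , drop-not-there sx∉A , refl

  connected-with-u-v : ∀ {A} → suc z ∉ A → zero ∉ A → StronglyConnectedMinus D A
  connected-with-u-v {A} u∉A v∉A = hub-connected zero to-v from-v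
    where
    to-u : ∀ x → x ∉ A → Walk D A x (suc z)
    to-u zero    x∉A = step x∉A refl (here u∉A)
    to-u (suc x) x∉A = case x ≟ z of λ where
      (yes refl) → here x∉A
      (no x≢z)   → step x∉A (arc-xu x≢z refl) (here u∉A)

    to-v : ∀ x → x ∉ A → Walk D A x zero
    to-v x x∉A = to-u x x∉A ++ʷ step u∉A arc-uv (here v∉A)

    from-v : ∀ y → y ∉ A → Walk D A zero y
    from-v zero    y∉A = here y∉A
    from-v (suc y) y∉A = step v∉A refl (here y∉A)

  connected-without-u : ∀ {A'} → z ∈ A' → StronglyConnectedMinus H (A' - z) →
                        StronglyConnectedMinus D (outside ∷ A')
  connected-without-u {A'} z∈A' = transfer asV asV-arc into onto
    where
    into : ∀ x → x ∉ A' - z → asV x ∉ outside ∷ A'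
    into x x∉B = case x ≟ z of λ where
      (yes x≡z) → subst (_∉ outside ∷ A') (sym (asV-≡ x≡z)) λ ()
      (no x≢z)  → subst (_∉ outside ∷ A') (sym (asV-≢ x≢z))
                    (λ sx∈A → x∉B (x∈p∧x≢y⇒x∈p-y (drop-there sx∈A) x≢z))

    onto : ∀ y → y ∉ outside ∷ A' → ∃ λ x → x ∉ A' - z × asV x ≡ y
    onto zero    _    = z , x∉p-x A' z , asV-≡ refl
    onto (suc y) sy∉A = y , (drop-not-there sy∉A ∘ p─q⊆p A' _) , asV-≢ y≢z
      where
      y≢z : y ≢ z
      y≢z refl = drop-not-there sy∉A z∈A'

lemma3p2 : (n k : ℕ) (H : Digraph n) → 2 ≤ k → 4 ≤ n → IsKStrong k H →
    (z : Fin n) → IsKStrong (suc k) (D_H H z)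
lemma3p2 n k H _ _ (k<n , conn) z = s≤s k<n , connected
  where
  connected : ∀ A → ∣ A ∣ ≤ k → StronglyConnectedMinus (D_H H z) A
  connected (inside ∷ A') ∣A∣≤k =
    connected-without-v H z A' (conn A' (<⇒≤∸1 ∣A∣≤k))
  connected (outside ∷ A') ∣A∣≤k with z ∈? A'
  ... | no z∉A'  = connected-with-u-v H z (z∉A' ∘ drop-there) λ ()
  ... | yes z∈A' = connected-without-u H z z∈A'
                     (conn (A' - z) (<⇒≤∸1 (<-≤-trans (x∈p⇒∣p-x∣<∣p∣ z∈A') ∣A∣≤k)))
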